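{- Let $G$ be a weighted game arena with partial observation, $\ell_{\max}\in\mathbb{N}_0$, and $\psi$ a play of $G$. There exists $\pi\in\gamma(\psi)$ that merges with infinitely many violating paths if and only if $\psi\notin\mathsf{UFix}(\ell_{\max})$.
   Context: A weighted game arena with partial observation (WGA) is a tuple $G=\langle Q,q_I,\Sigma,\Delta,w,Obs\rangle$ where $Q$ is a finite set of states, $q_I\in Q$ the initial state, $\Sigma$ a finite set of actions, $\Delta\subseteq Q\times\Sigma\times Q$ a total transition relation, $w:\Delta\to\mathbb{Z}$ a weight function, $Obs$ a partition of $Q$ with $\{q_I\}\in Obs$. Concrete paths are (finite or infinite) sequences $q_0\sigma_0q_1\dots$ with $(q_i,\sigma_i,q_{i+1})\in\Delta$; abstract paths are sequences $o_0\sigma_0o_1\dots$ ($o_i\in Obs$) realized by some concrete path with $q_i\in o_i$; $\gamma(\psi)$ is the set of concrete paths with the same actions and $q_i\in o_i$ for all $i$. For a path $\pi$, $\pi[k]$ is its $k$-th state/observation, $\pi[k..l]$ the segment from position $k$ to $l$, and $\pi[..k]=\pi[0..k]$. For concrete $\chi=q_0\sigma_0q_1\dots$, $w(\chi[k..l])=\sum_{i=k}^{l-1}w(q_i,\sigma_i,q_{i+1})$. A play is an infinite abstract path starting with $\{q_I\}$. $\mathbb{N}_0=\{1,2,\dots\}$. For a concrete path $\chi$ (of length at least $i+\ell$ if finite), $i\ge0$, $\ell\in\mathbb{N}_0$: $\chi\in\mathsf{GW}(i,\ell)$ iff some $1\le j\le\ell$ has $w(\chi[i..i+j])\ge0$.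 $\mathsf{UFix}(\ell)=\{\psi:\exists i\ge0\,\forall\pi\in\gamma(\psi)\,\forall j\ge i:\pi\in\mathsf{GW}(j,\ell)\}$. A concrete play $\pi\in\gamma(\psi)$ merges with infinitely many violating paths if for every $i\ge0$ there are $j\ge i$, $k\ge j+\ell_{\max}$ and a finite concrete path $\chi\in\gamma(\psi[..k])$ such that $\pi[k]=\chi[k]$ and $\chi\notin\mathsf{GW}(j,\ell_{\max})$. -}

module Defs where

open import Level using (0ℓ)
open import Data.Nat using (ℕ; zero; suc; _+_; _≤_; _<_; _≥_)
open import Data.Fin using (Fin)
open import Data.Integer as ℤ using (ℤ; +_)
open import Data.Product using (Σ; ∃; ∃-syntax; _×_; _,_)
open import Relation.Nullary using (¬_)
open import Relation.Binary.PropositionalEquality using (_≡_)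

-- States Q = Fin nQ, actions Σ = Fin nA, observations (cells of the
-- partition Obs) indexed by Fin nO via the map obs : Q → Fin nO
-- (state q lies in cell obs q).
record WGA : Set₁ where
  field
    nQ nA nO : ℕ
    qI    : Fin nQ
    Δ     : Fin nQ → Fin nA → Fin nQ → Set
    total : ∀ q σ → ∃[ q' ] Δ q σ q'
    w     : Fin nQ → Fin nA → Fin nQ → ℤ
    obs   : Fin nQ → Fin nO
    -- {qI} is a cell of the partition
    qI-singleton : ∀ q → obs q ≡ obs qI → q ≡ qI

module _ (G : WGA) where
  open WGA G

  record AbsPath : Set where
    field
      oseq : ℕ → Fin nO
      aseq : ℕ → Fin nA

  open AbsPath

  InGamma : AbsPath → (ℕ → Fin nQ) → Set
  InGamma ψ qs = (∀ i → Δ (qs i) (aseq ψ i) (qs (suc i)))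
               × (∀ i → obs (qs i) ≡ oseq ψ i)

  -- qs, restricted to positions 0..k, is a finite concrete path in γ(ψ[..k]).
  -- (Values of qs beyond position k are irrelevant.)
  InGammaPrefix : AbsPath → ℕ → (ℕ → Fin nQ) → Set
  InGammaPrefix ψ k qs = (∀ i → i < k → Δ (qs i) (aseq ψ i) (qs (suc i)))
                       × (∀ i → i ≤ k → obs (qs i) ≡ oseq ψ i)

  IsPlay : AbsPath → Set
  IsPlay ψ = (oseq ψ 0 ≡ obs qI) × ∃[ qs ] InGamma ψ qs

  segW : (ℕ → Fin nQ) → (ℕ → Fin nA) → ℕ → ℕ → ℤ
  segW qs as i zero    = + 0
  segW qs as i (suc j) = segW qs as i j ℤ.+ w (qs (i + j)) (as (i + j)) (qs (suc (i + j)))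

  GW : (ℕ → Fin nQ) → (ℕ → Fin nA) → ℕ → ℕ → Set
  GW qs as i ℓ = ∃[ j ] (1 ≤ j × j ≤ ℓ × + 0 ℤ.≤ segW qs as i j)

  UFix : ℕ → AbsPath → Set
  UFix ℓ ψ = ∃[ i ] ∀ (qs : ℕ → Fin nQ) → InGamma ψ qs →
               ∀ j → j ≥ i → GW qs (aseq ψ) j ℓ

  MergesInf : ℕ → AbsPath → (ℕ → Fin nQ) → Set
  MergesInf ℓmax ψ qs =
    ∀ i → ∃[ j ] (j ≥ i × ∃[ k ] (k ≥ j + ℓmax × ∃[ χ ]
      (InGammaPrefix ψ k χ × qs k ≡ χ k × ¬ GW χ (aseq ψ) j ℓmax)))

-- (⇒) A violating finite path that merges with π can be spliced onto the
-- rest of π, yielding a concrete play that violates GW arbitrarily late.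
-- (⇐) Classically, if no concrete play merges with infinitely many
-- violating paths, each one stops merging after some bound, while ¬ UFix
-- keeps supplying plays that violate GW after any given bound.  A late
-- violating play can never again share a state with a play that has stopped
-- merging, so iterating this produces nQ + 1 plays in pairwise different
-- states at one common position, contradicting the pigeonhole principle.
module Submission where

open import Defs
open import Level using (0ℓ)
open import Axiom.ExcludedMiddle using (ExcludedMiddle)
open import Axiom.DoubleNegationElimination using (DoubleNegationElimination; em⇒dne)
open import Data.Nat using (ℕ; suc; s≤s; _+_; _⊔_; _≤_; _<_; _≥_; _≤′_; ≤′-refl; ≤′-step; _≤?_)
open import Data.Nat.Properties
  using (≤-refl; ≤-trans; ≤-reflexive; ≤-antisym; ≤⇒≤′; <⇒≤; <⇒≱; ≤-<-connex; <-≤-connex; n≤1+n; n<1+n;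
         m≤m⊔n; m≤n⊔m; +-suc; +-monoʳ-≤)
open import Data.Fin as Fin using (Fin; toℕ)
open import Data.Fin.Properties using (pigeonhole; toℕ<n)
import Data.Integer as ℤ
open import Data.Sum using (inj₁; inj₂)
open import Data.Product using (∃; ∃₂; ∃-syntax; _×_; _,_; proj₁; proj₂)
open import Relation.Nullary using (¬_; yes; no; contradiction)
open import Function.Bundles using (_⇔_; mk⇔)
open import Relation.Binary.PropositionalEquality
  using (_≡_; _≢_; refl; sym; trans; cong; cong₂; subst; subst₂)

splice : {A : Set} → (ℕ → A) → (ℕ → A) → ℕ → ℕ → A
splice χ π k t with t ≤? k
... | yes _ = χ t
... | no  _ = π t

module _ {A : Set} (χ π : ℕ → A) (k : ℕ) where

  splice-≤ : ∀ {t} → t ≤ k → splice χ π k t ≡ χ t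
  splice-≤ {t} t≤k with t ≤? k
  ... | yes _   = refl
  ... | no  t≰k = contradiction t≤k t≰k

  splice-> : ∀ {t} → k < t → splice χ π k t ≡ π t
  splice-> {t} k<t with t ≤? k
  ... | yes t≤k = contradiction t≤k (<⇒≱ k<t)
  ... | no  _   = refl

  splice-≥ : π k ≡ χ k → ∀ {t} → k ≤ t → splice χ π k t ≡ π t
  splice-≥ πk≡χk {t} k≤t with t ≤? k
  ... | yes t≤k with refl ← ≤-antisym t≤k k≤t = sym πk≡χk
  ... | no  _   = refl

record Separating (n : ℕ) (P : (ℕ → Fin n) → Set) : Set where
  field
    bound     : ∀ {π} → P π → ℕ
    next      : ℕ → ∃ P
    time      : ℕ → ℕ
    separated : ∀ B {π} (p : P π) → bound p ≤ B →
                ∀ k → time B ≤ k → π k ≢ proj₁ (next B) k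

¬Separating : ∀ {n P} → ¬ Separating n P
¬Separating {n} S = collision (pigeonhole (n<1+n n) (λ r → play (toℕ r) K))
  where
    open Separating S

    -- Stage m + 1 lies beyond the bound and the separation time of play m.
    stage : ℕ → ℕ
    stage 0       = 0
    stage (suc m) = stage m ⊔ bound (proj₂ (next (stage m))) ⊔ time (stage m)

    play : ℕ → ℕ → Fin n
    play m = proj₁ (next (stage m))

    K : ℕ
    K = stage (suc n)

    stage-mono′ : ∀ {m m′} → m ≤′ m′ → stage m ≤ stage m′
    stage-mono′ ≤′-refl       = ≤-refl
    stage-mono′ (≤′-step m≤′) = ≤-trans (stage-mono′ m≤′) (≤-trans (m≤m⊔n _ _) (m≤m⊔n _ _))

    bound≤stage : ∀ {r s} → r < s → bound (proj₂ (next (stage r))) ≤ stage s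
    bound≤stage {r} r<s = ≤-trans (≤-trans (m≤n⊔m (stage r) _) (m≤m⊔n _ (time (stage r))))
                                  (stage-mono′ (≤⇒≤′ r<s))

    time≤stage : ∀ {s t} → s < t → time (stage s) ≤ stage t
    time≤stage s<t = ≤-trans (m≤n⊔m _ _) (stage-mono′ (≤⇒≤′ s<t))

    collision : ¬ ∃₂ λ r s → r Fin.< s × play (toℕ r) K ≡ play (toℕ s) K
    collision (r , s , r<s , same) =
      separated (stage (toℕ s)) (proj₂ (next (stage (toℕ r))))
                (bound≤stage r<s) K (time≤stage (toℕ<n s)) same

module _ (G : WGA) where
  open WGA G
  open AbsPath

  segW-cong : ∀ {f g : ℕ → Fin nQ} (as : ℕ → Fin nA) i m →
              (∀ {t} → t ≤ i + m → f t ≡ g t) → segW G f as i m ≡ segW G g as i m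
  segW-cong as i 0       f≡g = refl
  segW-cong as i (suc m) f≡g =
    cong₂ ℤ._+_ (segW-cong as i m (λ t≤ → f≡g (≤-trans t≤ i+m≤i+1+m)))
                (cong₂ (λ q q′ → w q (as (i + m)) q′)
                       (f≡g i+m≤i+1+m) (f≡g (≤-reflexive (sym (+-suc i m)))))
    where
      i+m≤i+1+m : i + m ≤ i + suc m
      i+m≤i+1+m = +-monoʳ-≤ i (n≤1+n m)

  GW-cong : ∀ {f g : ℕ → Fin nQ} (as : ℕ → Fin nA) i ℓ →
            (∀ {t} → t ≤ i + ℓ → f t ≡ g t) → GW G f as i ℓ → GW G g as i ℓ
  GW-cong as i ℓ f≡g (j , 1≤j , j≤ℓ , nonneg) =
    j , 1≤j , j≤ℓ ,
    subst (ℤ._≤_ (ℤ.+ 0)) (segW-cong as i j (λ t≤ → f≡g (≤-trans t≤ (+-monoʳ-≤ i j≤ℓ)))) nonneg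

  module _ (ψ : AbsPath G) where

    InGamma⇒InGammaPrefix : ∀ {π} k → InGamma G ψ π → InGammaPrefix G ψ k π
    InGamma⇒InGammaPrefix k (πΔ , πobs) = (λ t _ → πΔ t) , (λ t _ → πobs t)

    splice-InGamma : ∀ {χ π k} → InGammaPrefix G ψ k χ → InGamma G ψ π → π k ≡ χ k →
                     InGamma G ψ (splice χ π k)
    splice-InGamma {χ} {π} {k} (χΔ , χobs) (πΔ , πobs) πk≡χk = steps , observed
      where
        steps : ∀ t → Δ (splice χ π k t) (aseq ψ t) (splice χ π k (suc t))
        steps t with <-≤-connex t k
        ... | inj₁ t<k = subst₂ (λ q q′ → Δ q (aseq ψ t) q′)
                           (sym (splice-≤ χ π k (<⇒≤ t<k))) (sym (splice-≤ χ π k t<k))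
                           (χΔ t t<k)
        ... | inj₂ k≤t = subst₂ (λ q q′ → Δ q (aseq ψ t) q′)
                           (sym (splice-≥ χ π k πk≡χk k≤t)) (sym (splice-> χ π k (s≤s k≤t)))
                           (πΔ t)

        observed : ∀ t → obs (splice χ π k t) ≡ oseq ψ t
        observed t with ≤-<-connex t k
        ... | inj₁ t≤k = trans (cong obs (splice-≤ χ π k t≤k)) (χobs t t≤k)
        ... | inj₂ k<t = trans (cong obs (splice-> χ π k k<t)) (πobs t)

    module _ (ℓ : ℕ) where

      MergesAfter : ℕ → (ℕ → Fin nQ) → Set
      MergesAfter i π = ∃[ j ] (j ≥ i × ∃[ k ] (k ≥ j + ℓ × ∃[ χ ]
        (InGammaPrefix G ψ k χ × π k ≡ χ k × ¬ GW G χ (aseq ψ) j ℓ)))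

      ViolatesAfter : ℕ → (ℕ → Fin nQ) → Set
      ViolatesAfter i π = ∃[ j ] (j ≥ i × ¬ GW G π (aseq ψ) j ℓ)

      MergesAfter⇒ViolatesAfter : ∀ {i π} → InGamma G ψ π → MergesAfter i π →
                                  ∃[ π′ ] (InGamma G ψ π′ × ViolatesAfter i π′)
      MergesAfter⇒ViolatesAfter {π = π} γπ (j , j≥i , k , k≥j+ℓ , χ , γχ , πk≡χk , χbad) =
        splice χ π k , splice-InGamma γχ γπ πk≡χk , j , j≥i ,
        λ good → χbad (GW-cong (aseq ψ) j ℓ (λ t≤ → splice-≤ χ π k (≤-trans t≤ k≥j+ℓ)) good)

      MergesInf⇒¬UFix : ∀ {π} → InGamma G ψ π → MergesInf G ℓ ψ π → ¬ UFix G ℓ ψ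
      MergesInf⇒¬UFix γπ merges (i , good)
        with π′ , γπ′ , j , j≥i , bad ← MergesAfter⇒ViolatesAfter γπ (merges i)
        = bad (good π′ γπ′ j j≥i)

      module _ (dne : DoubleNegationElimination 0ℓ) where

        ¬UFix⇒ViolatesAfter : ¬ UFix G ℓ ψ → ∀ i → ∃[ π ] (InGamma G ψ π × ViolatesAfter i π)
        ¬UFix⇒ViolatesAfter ¬ufix i = dne λ none →
          ¬ufix (i , λ π γπ j j≥i → dne λ bad → none (π , γπ , j , j≥i , bad))

        ¬MergesInf⇒∃¬MergesAfter : ∀ {π} → ¬ MergesInf G ℓ ψ π → ∃[ b ] ¬ MergesAfter b π
        ¬MergesInf⇒∃¬MergesAfter ¬merges = dne λ none →
          ¬merges λ i → dne λ ¬merges-i → none (i , ¬merges-i)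

        ¬UFix⇒MergesInf : ¬ UFix G ℓ ψ → ∃[ π ] (InGamma G ψ π × MergesInf G ℓ ψ π)
        ¬UFix⇒MergesInf ¬ufix = dne λ none → ¬Separating (separating none)
          where
            separating : ¬ (∃[ π ] (InGamma G ψ π × MergesInf G ℓ ψ π)) →
                         Separating nQ (InGamma G ψ)
            separating none = record
              { bound     = λ γπ → proj₁ (stops γπ)
              ; next      = λ B → let π , γπ , _ = late B in π , γπ
              ; time      = λ B → let _ , _ , j , _ = late B in j + ℓ
              ; separated = λ B γπ b≤B k j+ℓ≤k πk≡vk →
                  let v , γv , j , j≥B , bad = late B
                  in proj₂ (stops γπ) (j , ≤-trans b≤B j≥B , k , j+ℓ≤k , v ,
                                       InGamma⇒InGammaPrefix k γv , πk≡vk , bad)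
              }
              where
                stops : ∀ {π} → InGamma G ψ π → ∃[ b ] ¬ MergesAfter b π
                stops γπ = ¬MergesInf⇒∃¬MergesAfter λ merges → none (_ , γπ , merges)

                late : ∀ B → ∃[ π ] (InGamma G ψ π × ViolatesAfter B π)
                late = ¬UFix⇒ViolatesAfter ¬ufix

lemma9 : ExcludedMiddle 0ℓ → (G : WGA) → (ℓmax : ℕ) → 1 ≤ ℓmax →
    (ψ : AbsPath G) → IsPlay G ψ →
    (∃[ π ] (InGamma G ψ π × MergesInf G ℓmax ψ π)) ⇔ (¬ UFix G ℓmax ψ)
lemma9 em G ℓmax _ ψ _ =
  mk⇔ (λ (_ , γπ , merges) → MergesInf⇒¬UFix G ψ ℓmax γπ merges)
      (¬UFix⇒MergesInf G ψ ℓmax (em⇒dne em))
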